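{- Let $\Gamma$ be an irreducible vertex-transitive graph and let $C$ be a strong clique in $\Gamma$. Then for any inclusion-maximal clique $C'\neq C$ of $\Gamma$ we have $|C\cap C'|<|C|-1$.
   Context: All graphs are finite and simple. A clique is strong if it intersects every inclusion-maximal independent set. A graph is reducible if it has two distinct vertices with the same (open) neighbourhood, and irreducible otherwise. A graph is vertex-transitive if its automorphism group acts transitively on its vertices. -}

module Defs where

open import Data.Nat using (ℕ)
open import Data.Fin using (Fin)
open import Data.Fin.Subset using (Subset; _∈_; _⊆_)
open import Data.Bool using (Bool; true; false)
open import Data.Product using (Σ; _×_; ∃)
open import Relation.Binary.PropositionalEquality using (_≡_; _≢_)
open import Function.Bundles using (_↔_)
open import Function.Bundles using (Inverse)
open import Relation.Nullary using (¬_)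

record Graph (n : ℕ) : Set where
  field
    adj   : Fin n → Fin n → Bool
    irrefl : ∀ v → adj v v ≡ false
    sym   : ∀ u v → adj u v ≡ adj v u

open Graph public

module _ {n : ℕ} (G : Graph n) where

  IsClique : Subset n → Set
  IsClique S = ∀ u v → u ∈ S → v ∈ S → u ≢ v → adj G u v ≡ true

  IsIndependent : Subset n → Set
  IsIndependent S = ∀ u v → u ∈ S → v ∈ S → adj G u v ≡ false

  IsMaximalClique : Subset n → Set
  IsMaximalClique S = IsClique S × (∀ T → IsClique T → S ⊆ T → T ⊆ S)

  IsMaximalIndependent : Subset n → Set
  IsMaximalIndependent S = IsIndependent S × (∀ T → IsIndependent T → S ⊆ T → T ⊆ S)

  IsStrongClique : Subset n → Set
  IsStrongClique C = IsClique C ×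
    (∀ I → IsMaximalIndependent I → ∃ λ v → v ∈ C × v ∈ I)

  IsReducible : Set
  IsReducible = Σ (Fin n) λ u → Σ (Fin n) λ v → u ≢ v × (∀ w → adj G u w ≡ adj G v w)

  IsIrreducible : Set
  IsIrreducible = ¬ IsReducible

  IsAutomorphism : (Fin n ↔ Fin n) → Set
  IsAutomorphism σ = ∀ u v → adj G (Inverse.to σ u) (Inverse.to σ v) ≡ adj G u v

  IsVertexTransitive : Set
  IsVertexTransitive = ∀ u v → Σ (Fin n ↔ Fin n) λ σ → IsAutomorphism σ × (Inverse.to σ u ≡ v)

-- A strong clique C is a maximal clique, so if |C ∩ C'| ≥ |C| - 1 for another
-- maximal clique C', then C ∖ C' = {x} and some y ∈ C' ∖ C is adjacent to all of
-- C except x.  Then N(x) ⊆ N(y): for z ∈ N(x) ∖ N(y) the independent set {y, z}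
-- would dominate C, but every independent set extends to a maximal one, which
-- meets C.  Vertex transitivity makes the graph regular, so N(x) = N(y) and the
-- distinct vertices x and y contradict irreducibility.

module Submission where

open import Defs
open import Data.Nat using (ℕ; _+_; _<_)
open import Data.Fin.Subset using (Subset; _∩_; ∣_∣)
open import Relation.Binary.PropositionalEquality using (_≢_)

open import Data.Nat using (zero; suc; _≤_; _<?_)
open import Data.Nat.Properties using (+-0-commutativeMonoid; +-comm; +-monoˡ-≤; ≮⇒≥; <⇒≱; ≤-reflexive; module ≤-Reasoning)
open import Data.Nat.Induction using (<-wellFounded)
open import Data.Fin as Fin using (Fin; _≟_)
open import Data.Fin.Properties using (any?; all?; ¬∀⟶∃¬)
open import Data.Fin.Subset using (_∈_; _∉_; _⊆_; _⊈_; _∪_; _-_; ⁅_⁆; ∁)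
open import Data.Fin.Subset.Properties
  using ( _∈?_; _⊆?_; ⊆-antisym; p⊆q⇒∣p∣≤∣q∣; p⊂q⇒∣p∣<∣q∣; x∈p⇒∣p-x∣<∣p∣; x∈p∧x≢y⇒x∈p-y
        ; x∈p∩q⁻; x∈p∪q⁺; x∈p∪q⁻; p⊆p∪q; x∈⁅x⁆; x∈⁅y⁆⇒x≡y; p⊂q⇒∁p⊃∁q )
open import Data.Bool using (Bool; true; false; if_then_else_)
open import Data.Bool.Properties using () renaming (_≟_ to _≟ᵇ_)
open import Data.Vec using (tabulate; lookup)
open import Data.Vec.Properties using (lookup∘tabulate; tabulate-cong; lookup⇒[]=; []=⇒lookup)
open import Data.Product using (_×_; _,_; ∃; ∃₂; proj₂)
open import Data.Sum using (inj₁; inj₂)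
open import Data.Empty using (⊥-elim)
open import Relation.Nullary using (¬_; yes; no)
open import Relation.Nullary.Decidable using (¬?; _×-dec_; _→-dec_)
open import Relation.Binary.PropositionalEquality using (_≡_; refl; cong; subst; module ≡-Reasoning)
import Relation.Binary.PropositionalEquality as ≡
open import Induction.WellFounded using (Acc; acc)
open import Function.Base using (_∘_)
open import Function.Bundles using (_↔_; Inverse)
open import Algebra.Properties.CommutativeMonoid.Sum +-0-commutativeMonoid using (sum; sum-permute)

private
  variable
    n : ℕ
    p q : Subset n
    x y : Fin n

⊈⇒∃∈∉ : p ⊈ q → ∃ λ x → x ∈ p × x ∉ q
⊈⇒∃∈∉ {n} {p} {q} p⊈q
  with ¬∀⟶∃¬ n (λ x → x ∈ p → x ∈ q) (λ x → x ∈? p →-dec x ∈? q) (λ p⊆q → p⊈q (p⊆q _))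
... | x , ¬x∈p⇒x∈q with x ∈? p
...   | yes x∈p = x , x∈p , λ x∈q → ¬x∈p⇒x∈q (λ _ → x∈q)
...   | no  x∉p = ⊥-elim (¬x∈p⇒x∈q (λ x∈p → ⊥-elim (x∉p x∈p)))

p⊆q∧∣q∣≤∣p∣⇒q⊆p : p ⊆ q → ∣ q ∣ ≤ ∣ p ∣ → q ⊆ p
p⊆q∧∣q∣≤∣p∣⇒q⊆p {p = p} {q} p⊆q ∣q∣≤∣p∣ with q ⊆? p
... | yes q⊆p = q⊆p
... | no  q⊈p with ⊈⇒∃∈∉ q⊈p
...   | x , x∈q , x∉p = ⊥-elim (<⇒≱ (p⊂q⇒∣p∣<∣q∣ (p⊆q , x , x∈q , x∉p)) ∣q∣≤∣p∣)

x∉q∧y∉q⇒∣p∩q∣+1<∣p∣ : x ∈ p → x ∉ q → y ∈ p → y ∉ q → y ≢ x → ∣ p ∩ q ∣ + 1 < ∣ p ∣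
x∉q∧y∉q⇒∣p∩q∣+1<∣p∣ {x = x} {p} {q} {y} x∈p x∉q y∈p y∉q y≢x = begin-strict
  ∣ p ∩ q ∣ + 1     ≤⟨ +-monoˡ-≤ 1 (p⊆q⇒∣p∣≤∣q∣ p∩q⊆p-x-y) ⟩
  ∣ p - x - y ∣ + 1 ≡⟨ +-comm _ 1 ⟩
  suc ∣ p - x - y ∣ ≤⟨ x∈p⇒∣p-x∣<∣p∣ (x∈p∧x≢y⇒x∈p-y y∈p y≢x) ⟩
  ∣ p - x ∣         <⟨ x∈p⇒∣p-x∣<∣p∣ x∈p ⟩
  ∣ p ∣             ∎
  where
  open ≤-Reasoning
  p∩q⊆p-x-y : p ∩ q ⊆ p - x - y
  p∩q⊆p-x-y z∈p∩q with x∈p∩q⁻ p q z∈p∩q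
  ... | z∈p , z∈q = x∈p∧x≢y⇒x∈p-y (x∈p∧x≢y⇒x∈p-y z∈p λ { refl → x∉q z∈q }) λ { refl → y∉q z∈q }

x∉p⇒∣∁p∪⁅x⁆∣<∣∁p∣ : x ∉ p → ∣ ∁ (p ∪ ⁅ x ⁆) ∣ < ∣ ∁ p ∣
x∉p⇒∣∁p∪⁅x⁆∣<∣∁p∣ {x = x} {p} x∉p = p⊂q⇒∣p∣<∣q∣ (p⊂q⇒∁p⊃∁q (p⊆p∪q ⁅ x ⁆ , x , x∈p∪q⁺ (inj₂ (x∈⁅x⁆ x)) , x∉p))

indicator : Bool → ℕ
indicator b = if b then 1 else 0

∣tabulate∣≡sum : (f : Fin n → Bool) → ∣ tabulate f ∣ ≡ sum (indicator ∘ f)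
∣tabulate∣≡sum {zero}  f = refl
∣tabulate∣≡sum {suc n} f with f Fin.zero
... | true  = cong suc (∣tabulate∣≡sum (f ∘ Fin.suc))
... | false = ∣tabulate∣≡sum (f ∘ Fin.suc)

∣tabulate∘permute∣ : (π : Fin n ↔ Fin n) (f : Fin n → Bool) → ∣ tabulate (f ∘ Inverse.to π) ∣ ≡ ∣ tabulate f ∣
∣tabulate∘permute∣ π f = begin
  ∣ tabulate (f ∘ Inverse.to π) ∣    ≡⟨ ∣tabulate∣≡sum (f ∘ Inverse.to π) ⟩
  sum (indicator ∘ f ∘ Inverse.to π) ≡⟨ sum-permute (indicator ∘ f) π ⟨
  sum (indicator ∘ f)                ≡⟨ ∣tabulate∣≡sum f ⟨
  ∣ tabulate f ∣                     ∎
  where open ≡-Reasoning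

module _ (G : Graph n) where

  neighbourhood : Fin n → Subset n
  neighbourhood v = tabulate (adj G v)

  degree : Fin n → ℕ
  degree v = ∣ neighbourhood v ∣

  ∈-neighbourhood⁺ : ∀ {v w} → adj G v w ≡ true → w ∈ neighbourhood v
  ∈-neighbourhood⁺ {v} {w} vw = lookup⇒[]= w (neighbourhood v) (≡.trans (lookup∘tabulate (adj G v) w) vw)

  ∈-neighbourhood⁻ : ∀ {v w} → w ∈ neighbourhood v → adj G v w ≡ true
  ∈-neighbourhood⁻ {v} {w} w∈N = ≡.trans (≡.sym (lookup∘tabulate (adj G v) w)) ([]=⇒lookup w∈N)

  automorphism-preserves-degree : (σ : Fin n ↔ Fin n) → IsAutomorphism G σ →
                                  ∀ v → degree (Inverse.to σ v) ≡ degree v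
  automorphism-preserves-degree σ σ-aut v =
    ≡.trans (≡.sym (∣tabulate∘permute∣ σ (adj G (Inverse.to σ v)))) (cong ∣_∣ (tabulate-cong (σ-aut v)))

  vertexTransitive⇒regular : IsVertexTransitive G → ∀ u v → degree u ≡ degree v
  vertexTransitive⇒regular vt u v with vt v u
  ... | σ , σ-aut , refl = automorphism-preserves-degree σ σ-aut v

  neighbourhood-⊆∧degree-≤⇒adj-≗ : neighbourhood x ⊆ neighbourhood y → degree y ≤ degree x →
                                   ∀ w → adj G x w ≡ adj G y w
  neighbourhood-⊆∧degree-≤⇒adj-≗ {x} {y} Nx⊆Ny deg≤ w = begin
    adj G x w                  ≡⟨ lookup∘tabulate (adj G x) w ⟨
    lookup (neighbourhood x) w ≡⟨ cong (λ s → lookup s w) (⊆-antisym Nx⊆Ny (p⊆q∧∣q∣≤∣p∣⇒q⊆p Nx⊆Ny deg≤)) ⟩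
    lookup (neighbourhood y) w ≡⟨ lookup∘tabulate (adj G y) w ⟩
    adj G y w                  ∎
    where open ≡-Reasoning

  ⁅⁆-independent : ∀ v → IsIndependent G ⁅ v ⁆
  ⁅⁆-independent v u w u∈ w∈ rewrite x∈⁅y⁆⇒x≡y v u∈ | x∈⁅y⁆⇒x≡y v w∈ = irrefl G v

  ∪⁅⁆-independent : ∀ {I v} → IsIndependent G I → (∀ u → u ∈ I → adj G v u ≡ false) →
                    IsIndependent G (I ∪ ⁅ v ⁆)
  ∪⁅⁆-independent {I} {v} indI v-indep u w u∈ w∈ with x∈p∪q⁻ I ⁅ v ⁆ u∈ | x∈p∪q⁻ I ⁅ v ⁆ w∈
  ... | inj₁ u∈I | inj₁ w∈I = indI u w u∈I w∈I
  ... | inj₂ u∈v | inj₁ w∈I rewrite x∈⁅y⁆⇒x≡y v u∈v = v-indep w w∈I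
  ... | inj₁ u∈I | inj₂ w∈v rewrite x∈⁅y⁆⇒x≡y v w∈v = ≡.trans (sym G u v) (v-indep u u∈I)
  ... | inj₂ u∈v | inj₂ w∈v rewrite x∈⁅y⁆⇒x≡y v u∈v | x∈⁅y⁆⇒x≡y v w∈v = irrefl G v

  independent⇒⊆maximalIndependent : ∀ I → IsIndependent G I → ∃ λ J → I ⊆ J × IsMaximalIndependent G J
  independent⇒⊆maximalIndependent I = extend I (<-wellFounded ∣ ∁ I ∣)
    where
    extend : ∀ I → Acc _<_ ∣ ∁ I ∣ → IsIndependent G I → ∃ λ J → I ⊆ J × IsMaximalIndependent G J
    extend I (acc rec) indI
      with any? (λ v → ¬? (v ∈? I) ×-dec all? (λ u → u ∈? I →-dec adj G v u ≟ᵇ false))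
    ... | yes (v , v∉I , v-indep)
      with extend (I ∪ ⁅ v ⁆) (rec (x∉p⇒∣∁p∪⁅x⁆∣<∣∁p∣ v∉I)) (∪⁅⁆-independent indI v-indep)
    ...   | J , I∪v⊆J , maxJ = J , (λ u∈I → I∪v⊆J (p⊆p∪q ⁅ v ⁆ u∈I)) , maxJ
    extend I _ indI | no stuck = I , (λ u∈I → u∈I) , indI , maximal
      where
      maximal : ∀ T → IsIndependent G T → I ⊆ T → T ⊆ I
      maximal T indT I⊆T {t} t∈T with t ∈? I
      ... | yes t∈I = t∈I
      ... | no  t∉I = ⊥-elim (stuck (t , t∉I , λ u u∈I → indT t u t∈T (I⊆T u∈I)))

  _Dominates_ : Subset n → Subset n → Set
  I Dominates C = ∀ c → c ∈ C → ∃ λ u → u ∈ I × adj G c u ≡ true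

  strongClique⇒¬independentDominates : ∀ {C I} → IsStrongClique G C → IsIndependent G I → ¬ (I Dominates C)
  strongClique⇒¬independentDominates {C} {I} (_ , meets) indI I-dom
    with independent⇒⊆maximalIndependent I indI
  ... | J , I⊆J , indJ , maxJ with meets J (indJ , maxJ)
  ...   | c , c∈C , c∈J with I-dom c c∈C
  ...     | u , u∈I , cu with ≡.trans (≡.sym cu) (indJ c u c∈J (I⊆J u∈I))
  ...       | ()

  strongClique⇒maximalClique : ∀ {C} → IsStrongClique G C → IsMaximalClique G C
  strongClique⇒maximalClique {C} strong@(Ccl , _) = Ccl , maximal
    where
    maximal : ∀ D → IsClique G D → C ⊆ D → D ⊆ C
    maximal D Dcl C⊆D with D ⊆? C
    ... | yes D⊆C = D⊆C
    ... | no  D⊈C with ⊈⇒∃∈∉ D⊈C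
    ...   | y , y∈D , y∉C = ⊥-elim (strongClique⇒¬independentDominates strong (⁅⁆-independent y) y-dom)
      where
      y-dom : ⁅ y ⁆ Dominates C
      y-dom c c∈C = y , x∈⁅x⁆ y , Dcl c y (C⊆D c∈C) y∈D (λ { refl → y∉C c∈C })

  adjacentToAllBut⇒neighbourhood-⊆ : ∀ {C} → IsStrongClique G C →
                                     (∀ c → c ∈ C → c ≢ x → adj G y c ≡ true) →
                                     neighbourhood x ⊆ neighbourhood y
  adjacentToAllBut⇒neighbourhood-⊆ {x} {y} {C} strong y-adj {z} z∈Nx with adj G y z in yz
  ... | true  = ∈-neighbourhood⁺ yz
  ... | false = ⊥-elim (strongClique⇒¬independentDominates strong yz-indep yz-dom)
    where
    yz-indep : IsIndependent G (⁅ y ⁆ ∪ ⁅ z ⁆)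
    yz-indep = ∪⁅⁆-independent (⁅⁆-independent y)
                 (λ u u∈ → subst (λ u → adj G z u ≡ false) (≡.sym (x∈⁅y⁆⇒x≡y y u∈)) (≡.trans (sym G z y) yz))
    yz-dom : (⁅ y ⁆ ∪ ⁅ z ⁆) Dominates C
    yz-dom c c∈C with c ≟ x
    ... | yes refl = z , x∈p∪q⁺ (inj₂ (x∈⁅x⁆ z)) , ∈-neighbourhood⁻ z∈Nx
    ... | no  c≢x  = y , x∈p∪q⁺ (inj₁ (x∈⁅x⁆ y)) , ≡.trans (sym G c y) (y-adj c c∈C c≢x)

  strongClique-∣∩∣⇒neighbourhood-⊆ : ∀ {C C'} → IsStrongClique G C → IsMaximalClique G C' → C' ≢ C →
                                     ∣ C ∣ ≤ ∣ C ∩ C' ∣ + 1 →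
                                     ∃₂ λ x y → x ≢ y × neighbourhood x ⊆ neighbourhood y
  strongClique-∣∩∣⇒neighbourhood-⊆ {C} {C'} strong@(Ccl , _) (C'cl , C'max) C'≢C ∣C∣≤
    with ⊈⇒∃∈∉ {p = C} {C'} (λ C⊆C' → C'≢C (⊆-antisym (proj₂ (strongClique⇒maximalClique strong) C' C'cl C⊆C') C⊆C'))
  ... | x , x∈C , x∉C' with ⊈⇒∃∈∉ {p = C'} {C} (λ C'⊆C → x∉C' (C'max C Ccl C'⊆C x∈C))
  ...   | y , y∈C' , y∉C = x , y , (λ { refl → x∉C' y∈C' }) , adjacentToAllBut⇒neighbourhood-⊆ strong y-adj
    where
    C-x⊆C' : ∀ c → c ∈ C → c ≢ x → c ∈ C'
    C-x⊆C' c c∈C c≢x with c ∈? C'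
    ... | yes c∈C' = c∈C'
    ... | no  c∉C' = ⊥-elim (<⇒≱ (x∉q∧y∉q⇒∣p∩q∣+1<∣p∣ x∈C x∉C' c∈C c∉C' c≢x) ∣C∣≤)
    y-adj : ∀ c → c ∈ C → c ≢ x → adj G y c ≡ true
    y-adj c c∈C c≢x = C'cl y c y∈C' (C-x⊆C' c c∈C c≢x) (λ { refl → y∉C c∈C })

lemma3p7 : {n : ℕ} (G : Graph n) → IsIrreducible G → IsVertexTransitive G →
    (C : Subset n) → IsStrongClique G C →
    (C' : Subset n) → IsMaximalClique G C' → C' ≢ C →
    ∣ C ∩ C' ∣ + 1 < ∣ C ∣
lemma3p7 G irreducible vt C strong C' maxC' C'≢C with ∣ C ∩ C' ∣ + 1 <? ∣ C ∣
... | yes bound = bound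
... | no ¬bound with strongClique-∣∩∣⇒neighbourhood-⊆ G strong maxC' C'≢C (≮⇒≥ ¬bound)
...   | x , y , x≢y , Nx⊆Ny = ⊥-elim (irreducible (x , y , x≢y , twins))
  where
  twins : ∀ w → adj G x w ≡ adj G y w
  twins = neighbourhood-⊆∧degree-≤⇒adj-≗ G Nx⊆Ny (≤-reflexive (vertexTransitive⇒regular G vt y x))
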